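{- Let $(H,\cdot,1,\Delta,\varepsilon,\lhd)$ be a left Post-Hopf algebra such that $\Delta$ is cocommutative. Then $(H,\cdot^{\mathrm{op}},1,\Delta,\varepsilon,\lhd^{\mathrm{op}})$ is a right Post-Hopf algebra, where $x\cdot^{\mathrm{op}}y=y\cdot x$ and $x\lhd^{\mathrm{op}}y=y\lhd x$.
   Context: Sweedler notation $\Delta(x)=x^{(1)}\otimes x^{(2)}$; $H\otimes H$ has the tensor product coalgebra structure; the convolution algebra $\mathrm{Hom}(H,\mathrm{Hom}(H))$ has product $(f\star g)(x)=f(x^{(1)})\circ g(x^{(2)})$ and unit $x\mapsto\varepsilon(x)\mathrm{Id}_H$. A left Post-Hopf algebra is a Hopf algebra $(H,\cdot,1,\Delta,\varepsilon)$ with a coalgebra morphism $\lhd:H\otimes H\to H$ such that for all $x,y,z$: $x\lhd(y\cdot z)=(x^{(1)}\lhd y)\cdot(x^{(2)}\lhd z)$, $x\lhd(y\lhd z)=(x^{(1)}\cdot(x^{(2)}\lhd y))\lhd z$, and $\alpha(x)(y)=x\lhd y$ defines a convolution-invertible $\alpha\in\mathrm{Hom}(H,\mathrm{Hom}(H))$. A right Post-Hopf algebra is a Hopf algebra $(H,\cdot,1,\Delta,\varepsilon)$ with a coalgebra morphism $\rhd:H\otimes H\to H$ such that for all $x,y,z$: $(x\cdot y)\rhd z=(x\rhd z^{(1)})\cdot(y\rhd z^{(2)})$, $(x\rhd y)\rhd z=x\rhd((y\rhd z^{(1)})\cdot z^{(2)})$, and $\gamma(x)(y)=y\rhd x$ defines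 a convolution-invertible $\gamma\in\mathrm{Hom}(H,\mathrm{Hom}(H))$. -}

module Defs where

open import Level using (Level; _⊔_)
open import Algebra.Bundles using (CommutativeRing)
open import Algebra.Module.Bundles using (Module)
open import Data.Nat using (ℕ)
open import Data.Fin using (Fin; zero; suc)
open import Data.Product using (∃; _×_)
open import Data.Vec using (Vec; []; _∷_; lookup; _[_]≔_; _[_]%=_)
open import Data.Vec.Relation.Binary.Pointwise.Inductive using (Pointwise)
open import Data.List using (List; []; _∷_; _++_; map; foldr; concatMap)
open import Relation.Nullary using (¬_)

record IsField {c ℓ : Level} (K : CommutativeRing c ℓ) : Set (c ⊔ ℓ) where
  open CommutativeRing K
  field
    1≉0     : ¬ (1# ≈ 0#)
    inverse : ∀ x → ¬ (x ≈ 0#) → ∃ λ y → (x * y) ≈ 1#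

module Hopf {c ℓ m ℓm : Level} (K : CommutativeRing c ℓ) (M : Module K m ℓm) where

  open CommutativeRing K using (_≈_; _+_; _*_; 1#) renaming (Carrier to k)
  open Module M using (_≈ᴹ_; _+ᴹ_; _*ₗ_; 0ᴹ) renaming (Carrierᴹ to H)

  Σᴹ : List H → H
  Σᴹ = foldr _+ᴹ_ 0ᴹ

  -- The n-fold tensor power H ⊗ ... ⊗ H, presented as a setoid:
  -- an element is a formal sum (a list) of pure tensors (vectors
  -- v = v₀ ⊗ ... ⊗ vₙ₋₁), and _∼_ is the least congruence generated by
  -- commutativity of formal sums and the multilinearity relations.
  -- (This is the usual construction of the tensor product as a quotient
  -- of the free abelian group on Hⁿ; inverses exist since
  -- (-a)⊗b + a⊗b ∼ 0⊗b ∼ 0.)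

  Tensor : ℕ → Set m
  Tensor n = List (Vec H n)

  infix 4 _∼_
  data _∼_ {n : ℕ} : Tensor n → Tensor n → Set (c ⊔ m ⊔ ℓm) where
    ∼-refl   : ∀ {s} → s ∼ s
    ∼-sym    : ∀ {s t} → s ∼ t → t ∼ s
    ∼-trans  : ∀ {s t u} → s ∼ t → t ∼ u → s ∼ u
    ∼-++     : ∀ {s s′ t t′} → s ∼ s′ → t ∼ t′ → s ++ t ∼ s′ ++ t′
    ∼-comm   : ∀ s t → s ++ t ∼ t ++ s
    ∼-elem   : ∀ {v w} → Pointwise _≈ᴹ_ v w → v ∷ [] ∼ w ∷ []
    ∼-add    : ∀ (i : Fin n) v a b →
               (v [ i ]≔ (a +ᴹ b)) ∷ [] ∼ (v [ i ]≔ a) ∷ (v [ i ]≔ b) ∷ []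
    ∼-zero   : ∀ (i : Fin n) v → (v [ i ]≔ 0ᴹ) ∷ [] ∼ []
    ∼-scalar : ∀ (i j : Fin n) (r : k) v →
               (v [ i ]%= (r *ₗ_)) ∷ [] ∼ (v [ j ]%= (r *ₗ_)) ∷ []

  infixr 5 _⊗_
  _⊗_ : H → H → Vec H 2
  a ⊗ b = a ∷ b ∷ []

  fst₂ snd₂ : Vec H 2 → H
  fst₂ v = lookup v zero
  snd₂ v = lookup v (suc zero)

  scaleT : k → Tensor 2 → Tensor 2
  scaleT r = map (λ v → v [ zero ]%= (r *ₗ_))

  -- Sweedler sums: Σ⟨ Δx ⟩ f  =  f(x⁽¹⁾, x⁽²⁾)  (summed)
  Σ⟨_⟩ : Tensor 2 → (H → H → H) → H
  Σ⟨ t ⟩ f = Σᴹ (map (λ v → f (fst₂ v) (snd₂ v)) t)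

  pairT : (H → H → H) → Tensor 2 → Tensor 2 → Tensor 2
  pairT f s t = concatMap (λ u → map (λ w → f (fst₂ u) (fst₂ w) ⊗ f (snd₂ u) (snd₂ w)) t) s

  record IsLinear (g : H → H) : Set (c ⊔ m ⊔ ℓm) where
    field
      cong  : ∀ {x y} → x ≈ᴹ y → g x ≈ᴹ g y
      additive : ∀ x y → g (x +ᴹ y) ≈ᴹ g x +ᴹ g y
      homogeneous : ∀ (r : k) x → g (r *ₗ x) ≈ᴹ r *ₗ g x

  record IsBilinear (f : H → H → H) : Set (c ⊔ m ⊔ ℓm) where
    field
      cong  : ∀ {x x′ y y′} → x ≈ᴹ x′ → y ≈ᴹ y′ → f x y ≈ᴹ f x′ y′
      additiveˡ : ∀ x x′ y → f (x +ᴹ x′) y ≈ᴹ f x y +ᴹ f x′ y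
      additiveʳ : ∀ x y y′ → f x (y +ᴹ y′) ≈ᴹ f x y +ᴹ f x y′
      homogeneousˡ : ∀ (r : k) x y → f (r *ₗ x) y ≈ᴹ r *ₗ f x y
      homogeneousʳ : ∀ (r : k) x y → f x (r *ₗ y) ≈ᴹ r *ₗ f x y

  record IsHopfAlgebra (_·_ : H → H → H) (one : H)
                       (Δ : H → Tensor 2) (ε : H → k) : Set (c ⊔ ℓ ⊔ m ⊔ ℓm) where
    field
      ·-bilinear : IsBilinear _·_
      ·-assoc    : ∀ x y z → (x · y) · z ≈ᴹ x · (y · z)
      ·-identityˡ : ∀ x → one · x ≈ᴹ x
      ·-identityʳ : ∀ x → x · one ≈ᴹ x
      Δ-cong     : ∀ {x y} → x ≈ᴹ y → Δ x ∼ Δ y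
      Δ-additive : ∀ x y → Δ (x +ᴹ y) ∼ Δ x ++ Δ y
      Δ-homogeneous : ∀ (r : k) x → Δ (r *ₗ x) ∼ scaleT r (Δ x)
      ε-cong     : ∀ {x y} → x ≈ᴹ y → ε x ≈ ε y
      ε-additive : ∀ x y → ε (x +ᴹ y) ≈ ε x + ε y
      ε-homogeneous : ∀ (r : k) x → ε (r *ₗ x) ≈ r * ε x
      coassoc    : ∀ x →
        concatMap (λ u → map (λ w → fst₂ w ∷ snd₂ w ∷ snd₂ u ∷ []) (Δ (fst₂ u))) (Δ x)
          ∼ concatMap (λ u → map (λ w → fst₂ u ∷ fst₂ w ∷ snd₂ w ∷ []) (Δ (snd₂ u))) (Δ x)
      counitˡ    : ∀ x → Σ⟨ Δ x ⟩ (λ a b → ε a *ₗ b) ≈ᴹ x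
      counitʳ    : ∀ x → Σ⟨ Δ x ⟩ (λ a b → ε b *ₗ a) ≈ᴹ x
      Δ-mult     : ∀ x y → Δ (x · y) ∼ pairT _·_ (Δ x) (Δ y)
      Δ-unit     : Δ one ∼ (one ⊗ one) ∷ []
      ε-mult     : ∀ x y → ε (x · y) ≈ ε x * ε y
      ε-unit     : ε one ≈ 1#
      S          : H → H
      S-linear   : IsLinear S
      antipodeˡ  : ∀ x → Σ⟨ Δ x ⟩ (λ a b → S a · b) ≈ᴹ ε x *ₗ one
      antipodeʳ  : ∀ x → Σ⟨ Δ x ⟩ (λ a b → a · S b) ≈ᴹ ε x *ₗ one

  Cocommutative : (Δ : H → Tensor 2) → Set (c ⊔ m ⊔ ℓm)
  Cocommutative Δ = ∀ x → map (λ v → snd₂ v ⊗ fst₂ v) (Δ x) ∼ Δ x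

  -- a map f : H ⊗ H → H (given as a bilinear map) is a coalgebra morphism,
  -- H ⊗ H carrying the tensor product coalgebra structure
  record IsCoalgebraMorphism₂ (Δ : H → Tensor 2) (ε : H → k)
                              (f : H → H → H) : Set (c ⊔ ℓ ⊔ m ⊔ ℓm) where
    field
      bilinear : IsBilinear f
      Δ-comm   : ∀ x y → Δ (f x y) ∼ pairT f (Δ x) (Δ y)
      ε-comm   : ∀ x y → ε (f x y) ≈ ε x * ε y

  record IsLeftPostHopf (_·_ : H → H → H) (one : H) (Δ : H → Tensor 2)
                        (ε : H → k) (_◁_ : H → H → H) : Set (c ⊔ ℓ ⊔ m ⊔ ℓm) where
    field
      hopf     : IsHopfAlgebra _·_ one Δ ε
      ◁-coalg  : IsCoalgebraMorphism₂ Δ ε _◁_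
      ◁-mult   : ∀ x y z → x ◁ (y · z) ≈ᴹ Σ⟨ Δ x ⟩ (λ a b → (a ◁ y) · (b ◁ z))
      ◁-assoc  : ∀ x y z → x ◁ (y ◁ z) ≈ᴹ Σ⟨ Δ x ⟩ (λ a b → (a · (b ◁ y)) ◁ z)
      -- α(x)(y) = x ◁ y is convolution invertible in Hom(H, Hom(H)),
      -- with inverse β(x)(y) = β x y
      β        : H → H → H
      β-bilinear : IsBilinear β
      α⋆β      : ∀ x y → Σ⟨ Δ x ⟩ (λ a b → a ◁ β b y) ≈ᴹ ε x *ₗ y
      β⋆α      : ∀ x y → Σ⟨ Δ x ⟩ (λ a b → β a (b ◁ y)) ≈ᴹ ε x *ₗ y

  record IsRightPostHopf (_·_ : H → H → H) (one : H) (Δ : H → Tensor 2)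
                         (ε : H → k) (_▷_ : H → H → H) : Set (c ⊔ ℓ ⊔ m ⊔ ℓm) where
    field
      hopf     : IsHopfAlgebra _·_ one Δ ε
      ▷-coalg  : IsCoalgebraMorphism₂ Δ ε _▷_
      ▷-mult   : ∀ x y z → (x · y) ▷ z ≈ᴹ Σ⟨ Δ z ⟩ (λ a b → (x ▷ a) · (y ▷ b))
      ▷-assoc  : ∀ x y z → (x ▷ y) ▷ z ≈ᴹ x ▷ Σ⟨ Δ z ⟩ (λ a b → (y ▷ a) · b)
      -- γ(x)(y) = y ▷ x is convolution invertible in Hom(H, Hom(H)),
      -- with inverse δ(x)(y) = δ x y
      δ        : H → H → H
      δ-bilinear : IsBilinear δ
      γ⋆δ      : ∀ x y → Σ⟨ Δ x ⟩ (λ a b → δ b y ▷ a) ≈ᴹ ε x *ₗ y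
      δ⋆γ      : ∀ x y → Σ⟨ Δ x ⟩ (λ a b → δ a (y ▷ b)) ≈ᴹ ε x *ₗ y

{-# OPTIONS --safe #-}
-- The opposite multiplication reverses the order of the two factors in the
-- Post-Hopf identities, so (x ·ᵒᵖ y) ◁ᵒᵖ z and (x ◁ᵒᵖ y) ◁ᵒᵖ z come out as
-- Sweedler sums over Δz whose legs are in the wrong order; cocommutativity
-- exchanges the legs back.  The same exchange turns the antipode of H into an
-- antipode of Hᵒᵖ.  Finally γ(x)(y) = y ◁ᵒᵖ x = x ◁ y, so γ is α itself and
-- its convolution inverse is that of α.
module Submission where

open import Defs
open import Level using (Level; _⊔_)
open import Algebra.Bundles using (CommutativeRing)
open import Algebra.Module.Bundles using (Module)
open import Data.Fin using (zero; suc)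
open import Data.List using (List; []; _∷_; _++_; map; concatMap)
open import Data.List.Properties using (++-assoc)
open import Data.Nat using (ℕ)
open import Data.Vec using (Vec; []; _∷_)
open import Data.Vec.Relation.Binary.Pointwise.Inductive using ([]; _∷_)
open import Function using (flip)
open import Relation.Binary.Bundles using (Setoid)
import Relation.Binary.Reasoning.Setoid as SetoidReasoning

module OppositeProperties {c ℓ m ℓm : Level} (K : CommutativeRing c ℓ) (M : Module K m ℓm) where

  open Hopf K M
  open CommutativeRing K using (0#)
  open Module M renaming (Carrierᴹ to H)

  tensor-setoid : ℕ → Setoid m (c ⊔ m ⊔ ℓm)
  tensor-setoid n = record
    { Carrier = Tensor n
    ; _≈_ = _∼_
    ; isEquivalence = record { refl = ∼-refl ; sym = ∼-sym ; trans = ∼-trans }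
    }

  ∼-∷ : ∀ {n} (v : Vec H n) {s t : Tensor n} → s ∼ t → v ∷ s ∼ v ∷ t
  ∼-∷ v = ∼-++ {s = v ∷ []} ∼-refl

  concatMap-[] : ∀ {n} {B : Set m} (t : List B) → _∼_ {n} (concatMap (λ _ → []) t) []
  concatMap-[] []      = ∼-refl
  concatMap-[] (_ ∷ t) = concatMap-[] t

  concatMap-∷ : ∀ {n} {B : Set m} (g : B → Vec H n) (h : B → Tensor n) (t : List B) →
                concatMap (λ b → g b ∷ h b) t ∼ map g t ++ concatMap h t
  concatMap-∷ g h []      = ∼-refl
  concatMap-∷ g h (b ∷ t) = ∼-∷ (g b) (begin
    h b ++ concatMap (λ b → g b ∷ h b) t  ≈⟨ ∼-++ {s = h b} ∼-refl (concatMap-∷ g h t) ⟩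
    h b ++ (map g t ++ concatMap h t)     ≡⟨ ++-assoc (h b) (map g t) (concatMap h t) ⟨
    (h b ++ map g t) ++ concatMap h t     ≈⟨ ∼-++ (∼-comm (h b) (map g t)) ∼-refl ⟩
    (map g t ++ h b) ++ concatMap h t     ≡⟨ ++-assoc (map g t) (h b) (concatMap h t) ⟩
    map g t ++ (h b ++ concatMap h t)     ∎)
    where open SetoidReasoning (tensor-setoid _)

  concatMap-map-comm : ∀ {n} {A B : Set m} (G : A → B → Vec H n) (s : List A) (t : List B) →
                       concatMap (λ a → map (G a) t) s ∼ concatMap (λ b → map (flip G b) s) t
  concatMap-map-comm G []      t = ∼-sym (concatMap-[] t)
  concatMap-map-comm G (a ∷ s) t = ∼-trans (∼-++ ∼-refl (concatMap-map-comm G s t))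
    (∼-sym (concatMap-∷ (G a) (λ b → map (flip G b) s) t))

  pairT-flip : ∀ f s t → pairT f s t ∼ pairT (flip f) t s
  pairT-flip f s t = concatMap-map-comm (λ u w → f (fst₂ u) (fst₂ w) ⊗ f (snd₂ u) (snd₂ w)) s t

  id-linear : IsLinear (λ x → x)
  id-linear = record { cong = λ p → p ; additive = λ _ _ → ≈ᴹ-refl ; homogeneous = λ _ _ → ≈ᴹ-refl }

  linear-zero : ∀ {g} → IsLinear g → g 0ᴹ ≈ᴹ 0ᴹ
  linear-zero {g} G = begin
    g 0ᴹ         ≈⟨ cong (*ₗ-zeroˡ 0ᴹ) ⟨
    g (0# *ₗ 0ᴹ) ≈⟨ homogeneous 0# 0ᴹ ⟩
    0# *ₗ g 0ᴹ   ≈⟨ *ₗ-zeroˡ _ ⟩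
    0ᴹ           ∎
    where
    open IsLinear G
    open SetoidReasoning ≈ᴹ-setoid

  bilinear⇒linearˡ : ∀ {f} → IsBilinear f → ∀ y → IsLinear (λ x → f x y)
  bilinear⇒linearˡ B y = record
    { cong = λ p → cong p ≈ᴹ-refl
    ; additive = λ x x′ → additiveˡ x x′ y
    ; homogeneous = λ r x → homogeneousˡ r x y
    }
    where open IsBilinear B

  bilinear⇒linearʳ : ∀ {f} → IsBilinear f → ∀ x → IsLinear (f x)
  bilinear⇒linearʳ B x = record
    { cong = cong ≈ᴹ-refl
    ; additive = additiveʳ x
    ; homogeneous = λ r y → homogeneousʳ r x y
    }
    where open IsBilinear B

  flip-bilinear : ∀ {f} → IsBilinear f → IsBilinear (flip f)
  flip-bilinear B = record
    { cong = λ p q → cong q p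
    ; additiveˡ = λ x x′ y → additiveʳ y x x′
    ; additiveʳ = λ x y y′ → additiveˡ y y′ x
    ; homogeneousˡ = λ r x y → homogeneousʳ r y x
    ; homogeneousʳ = λ r x y → homogeneousˡ r y x
    }
    where open IsBilinear B

  bilinear-precompose : ∀ {f g h} → IsBilinear f → IsLinear g → IsLinear h →
                        IsBilinear (λ x y → f (g x) (h y))
  bilinear-precompose B G L = record
    { cong = λ p q → B.cong (G.cong p) (L.cong q)
    ; additiveˡ = λ x x′ y → ≈ᴹ-trans (B.cong (G.additive x x′) ≈ᴹ-refl) (B.additiveˡ _ _ _)
    ; additiveʳ = λ x y y′ → ≈ᴹ-trans (B.cong ≈ᴹ-refl (L.additive y y′)) (B.additiveʳ _ _ _)
    ; homogeneousˡ = λ r x y → ≈ᴹ-trans (B.cong (G.homogeneous r x) ≈ᴹ-refl) (B.homogeneousˡ _ _ _)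
    ; homogeneousʳ = λ r x y → ≈ᴹ-trans (B.cong ≈ᴹ-refl (L.homogeneous r y)) (B.homogeneousʳ _ _ _)
    }
    where
    module B = IsBilinear B
    module G = IsLinear G
    module L = IsLinear L

  bilinear-postcompose : ∀ {f g} → IsLinear g → IsBilinear f → IsBilinear (λ x y → g (f x y))
  bilinear-postcompose G B = record
    { cong = λ p q → G.cong (B.cong p q)
    ; additiveˡ = λ x x′ y → ≈ᴹ-trans (G.cong (B.additiveˡ x x′ y)) (G.additive _ _)
    ; additiveʳ = λ x y y′ → ≈ᴹ-trans (G.cong (B.additiveʳ x y y′)) (G.additive _ _)
    ; homogeneousˡ = λ r x y → ≈ᴹ-trans (G.cong (B.homogeneousˡ r x y)) (G.homogeneous _ _)
    ; homogeneousʳ = λ r x y → ≈ᴹ-trans (G.cong (B.homogeneousʳ r x y)) (G.homogeneous _ _)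
    }
    where
    module B = IsBilinear B
    module G = IsLinear G

  Σ-++ : ∀ (f : H → H → H) s t → Σ⟨ s ++ t ⟩ f ≈ᴹ Σ⟨ s ⟩ f +ᴹ Σ⟨ t ⟩ f
  Σ-++ f []      t = ≈ᴹ-sym (+ᴹ-identityˡ _)
  Σ-++ f (v ∷ s) t = ≈ᴹ-trans (+ᴹ-cong ≈ᴹ-refl (Σ-++ f s t)) (≈ᴹ-sym (+ᴹ-assoc _ _ _))

  Σ-cong : ∀ {f} → IsBilinear f → ∀ {s t} → s ∼ t → Σ⟨ s ⟩ f ≈ᴹ Σ⟨ t ⟩ f
  Σ-cong B ∼-refl          = ≈ᴹ-refl
  Σ-cong B (∼-sym p)       = ≈ᴹ-sym (Σ-cong B p)
  Σ-cong B (∼-trans p q)   = ≈ᴹ-trans (Σ-cong B p) (Σ-cong B q)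
  Σ-cong {f} B (∼-++ {s} {s′} {t} {t′} p q) =
    ≈ᴹ-trans (Σ-++ f s t) (≈ᴹ-trans (+ᴹ-cong (Σ-cong B p) (Σ-cong B q)) (≈ᴹ-sym (Σ-++ f s′ t′)))
  Σ-cong {f} B (∼-comm s t) =
    ≈ᴹ-trans (Σ-++ f s t) (≈ᴹ-trans (+ᴹ-comm _ _) (≈ᴹ-sym (Σ-++ f t s)))
  Σ-cong B (∼-elem (p ∷ q ∷ [])) = +ᴹ-cong (cong p q) ≈ᴹ-refl
    where open IsBilinear B
  Σ-cong B (∼-add zero (x ∷ y ∷ []) a b) =
    ≈ᴹ-trans (+ᴹ-identityʳ _) (≈ᴹ-trans (additiveˡ a b y) (+ᴹ-cong ≈ᴹ-refl (≈ᴹ-sym (+ᴹ-identityʳ _))))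
    where open IsBilinear B
  Σ-cong B (∼-add (suc zero) (x ∷ y ∷ []) a b) =
    ≈ᴹ-trans (+ᴹ-identityʳ _) (≈ᴹ-trans (additiveʳ x a b) (+ᴹ-cong ≈ᴹ-refl (≈ᴹ-sym (+ᴹ-identityʳ _))))
    where open IsBilinear B
  Σ-cong B (∼-zero zero (x ∷ y ∷ [])) =
    ≈ᴹ-trans (+ᴹ-identityʳ _) (linear-zero (bilinear⇒linearˡ B y))
  Σ-cong B (∼-zero (suc zero) (x ∷ y ∷ [])) =
    ≈ᴹ-trans (+ᴹ-identityʳ _) (linear-zero (bilinear⇒linearʳ B x))
  Σ-cong B (∼-scalar zero zero r (x ∷ y ∷ []))             = ≈ᴹ-refl
  Σ-cong B (∼-scalar (suc zero) (suc zero) r (x ∷ y ∷ [])) = ≈ᴹ-refl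
  Σ-cong B (∼-scalar zero (suc zero) r (x ∷ y ∷ [])) =
    +ᴹ-cong (≈ᴹ-trans (homogeneousˡ r x y) (≈ᴹ-sym (homogeneousʳ r x y))) ≈ᴹ-refl
    where open IsBilinear B
  Σ-cong B (∼-scalar (suc zero) zero r (x ∷ y ∷ [])) =
    +ᴹ-cong (≈ᴹ-trans (homogeneousʳ r x y) (≈ᴹ-sym (homogeneousˡ r x y))) ≈ᴹ-refl
    where open IsBilinear B

  Σ-swap : ∀ (f : H → H → H) t → Σ⟨ map (λ v → snd₂ v ⊗ fst₂ v) t ⟩ f ≈ᴹ Σ⟨ t ⟩ (flip f)
  Σ-swap f []      = ≈ᴹ-refl
  Σ-swap f (v ∷ t) = +ᴹ-cong ≈ᴹ-refl (Σ-swap f t)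

  Σ-linear : ∀ {g} → IsLinear g → ∀ (f : H → H → H) t → g (Σ⟨ t ⟩ f) ≈ᴹ Σ⟨ t ⟩ (λ a b → g (f a b))
  Σ-linear G f []      = linear-zero G
  Σ-linear G f (v ∷ t) = ≈ᴹ-trans (IsLinear.additive G _ _) (+ᴹ-cong ≈ᴹ-refl (Σ-linear G f t))

  cocommutative⇒Σ-flip : ∀ {Δ} → Cocommutative Δ → ∀ {f} → IsBilinear f → ∀ x →
                         Σ⟨ Δ x ⟩ f ≈ᴹ Σ⟨ Δ x ⟩ (flip f)
  cocommutative⇒Σ-flip {Δ} cc {f} B x = ≈ᴹ-trans (≈ᴹ-sym (Σ-cong B (cc x))) (Σ-swap f (Δ x))

  flip-isCoalgebraMorphism₂ : ∀ {Δ ε f} → IsCoalgebraMorphism₂ Δ ε f →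
                              IsCoalgebraMorphism₂ Δ ε (flip f)
  flip-isCoalgebraMorphism₂ {Δ} {f = f} F = record
    { bilinear = flip-bilinear bilinear
    ; Δ-comm = λ x y → ∼-trans (Δ-comm y x) (pairT-flip f (Δ y) (Δ x))
    ; ε-comm = λ x y → K.trans (ε-comm y x) (K.*-comm _ _)
    }
    where
    open IsCoalgebraMorphism₂ F
    module K = CommutativeRing K

  opposite-isHopfAlgebra : ∀ {_·_ one Δ ε} → Cocommutative Δ →
                           IsHopfAlgebra _·_ one Δ ε → IsHopfAlgebra (flip _·_) one Δ ε
  opposite-isHopfAlgebra {_·_} {Δ = Δ} cc 𝓗 = record
    { ·-bilinear = flip-bilinear ·-bilinear
    ; ·-assoc = λ x y z → ≈ᴹ-sym (·-assoc z y x)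
    ; ·-identityˡ = ·-identityʳ
    ; ·-identityʳ = ·-identityˡ
    ; Δ-cong = Δ-cong
    ; Δ-additive = Δ-additive
    ; Δ-homogeneous = Δ-homogeneous
    ; ε-cong = ε-cong
    ; ε-additive = ε-additive
    ; ε-homogeneous = ε-homogeneous
    ; coassoc = coassoc
    ; counitˡ = counitˡ
    ; counitʳ = counitʳ
    ; Δ-mult = λ x y → ∼-trans (Δ-mult y x) (pairT-flip _·_ (Δ y) (Δ x))
    ; Δ-unit = Δ-unit
    ; ε-mult = λ x y → K.trans (ε-mult y x) (K.*-comm _ _)
    ; ε-unit = ε-unit
    ; S = S
    ; S-linear = S-linear
    ; antipodeˡ = λ x →
        ≈ᴹ-trans (≈ᴹ-sym (cocommutative⇒Σ-flip cc (bilinear-precompose ·-bilinear id-linear S-linear) x))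
                 (antipodeʳ x)
    ; antipodeʳ = λ x →
        ≈ᴹ-trans (≈ᴹ-sym (cocommutative⇒Σ-flip cc (bilinear-precompose ·-bilinear S-linear id-linear) x))
                 (antipodeˡ x)
    }
    where
    open IsHopfAlgebra 𝓗
    module K = CommutativeRing K

mainTheorem6 : {c ℓ m ℓm : Level} (K : CommutativeRing c ℓ) → IsField K →
    (M : Module K m ℓm) →
    (_·_ : Module.Carrierᴹ M → Module.Carrierᴹ M → Module.Carrierᴹ M) →
    (one : Module.Carrierᴹ M) →
    (Δ : Module.Carrierᴹ M → List (Vec (Module.Carrierᴹ M) 2)) →
    (ε : Module.Carrierᴹ M → CommutativeRing.Carrier K) →
    (_◁_ : Module.Carrierᴹ M → Module.Carrierᴹ M → Module.Carrierᴹ M) →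
    Hopf.IsLeftPostHopf K M _·_ one Δ ε _◁_ →
    Hopf.Cocommutative K M Δ →
    Hopf.IsRightPostHopf K M (λ x y → y · x) one Δ ε (λ x y → y ◁ x)
mainTheorem6 K _ M _·_ one Δ ε _◁_ P cc = record
  { hopf = opposite-isHopfAlgebra cc hopf
  ; ▷-coalg = flip-isCoalgebraMorphism₂ ◁-coalg
  ; ▷-mult = flipped-◁-mult
  ; ▷-assoc = flipped-◁-assoc
  ; δ = β
  ; δ-bilinear = β-bilinear
  ; γ⋆δ = α⋆β
  ; δ⋆γ = β⋆α
  }
  where
  open Hopf K M
  open OppositeProperties K M
  open Module M using (_≈ᴹ_; ≈ᴹ-setoid)
  open IsLeftPostHopf P
  open IsHopfAlgebra hopf using (·-bilinear)
  open SetoidReasoning ≈ᴹ-setoid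

  ◁-linearˡ : ∀ y → IsLinear (_◁ y)
  ◁-linearˡ = bilinear⇒linearˡ (IsCoalgebraMorphism₂.bilinear ◁-coalg)

  Σ-flip : ∀ {f} → IsBilinear f → ∀ x → Σ⟨ Δ x ⟩ f ≈ᴹ Σ⟨ Δ x ⟩ (flip f)
  Σ-flip = cocommutative⇒Σ-flip cc

  flipped-◁-mult : ∀ x y z → z ◁ (y · x) ≈ᴹ Σ⟨ Δ z ⟩ (λ a b → (b ◁ y) · (a ◁ x))
  flipped-◁-mult x y z = begin
    z ◁ (y · x)                            ≈⟨ ◁-mult z y x ⟩
    Σ⟨ Δ z ⟩ (λ a b → (a ◁ y) · (b ◁ x))  ≈⟨ Σ-flip (bilinear-precompose ·-bilinear (◁-linearˡ y) (◁-linearˡ x)) z ⟩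
    Σ⟨ Δ z ⟩ (λ a b → (b ◁ y) · (a ◁ x))  ∎

  flipped-◁-assoc : ∀ x y z → z ◁ (y ◁ x) ≈ᴹ Σ⟨ Δ z ⟩ (λ a b → b · (a ◁ y)) ◁ x
  flipped-◁-assoc x y z = begin
    z ◁ (y ◁ x)                            ≈⟨ ◁-assoc z y x ⟩
    Σ⟨ Δ z ⟩ (λ a b → (a · (b ◁ y)) ◁ x)  ≈⟨ Σ-flip (bilinear-postcompose (◁-linearˡ x) ·◁y-bilinear) z ⟩
    Σ⟨ Δ z ⟩ (λ a b → (b · (a ◁ y)) ◁ x)  ≈⟨ Σ-linear (◁-linearˡ x) (λ a b → b · (a ◁ y)) (Δ z) ⟨
    Σ⟨ Δ z ⟩ (λ a b → b · (a ◁ y)) ◁ x    ∎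
    where
    ·◁y-bilinear : IsBilinear (λ a b → a · (b ◁ y))
    ·◁y-bilinear = bilinear-precompose ·-bilinear id-linear (◁-linearˡ y)
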